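{- Let $n$ be a positive integer and let $a,b,c,\alpha$ be positive integers such that $\binom{\alpha+n}{n}+a=b+c$ and $a,b,c<\binom{\alpha+n}{n}$. Then $$\binom{\alpha+n}{n}^{<n>}+a^{<n>}\le b^{<n>}+c^{<n>}.$$ Moreover, if $\binom{\alpha+n}{n}^{<n>}+a^{<n>}=b^{<n>}+c^{<n>}$, then $$\Big\{\binom{\alpha+n}{n}^{<n>}\Big\}^{<n>}+\{a^{<n>}\}^{<n>}=\{b^{<n>}\}^{<n>}+\{c^{<n>}\}^{<n>}.$$
   Context: For positive integers $n$ and $h$, $h$ can be written uniquely as $h=\sum_{j=i}^{n}\binom{h(j)+j}{j}$ with $h(n)\ge h(n-1)\ge\dots\ge h(i)\ge 0$ and $i\ge 1$ (the $n$th binomial representation of $h$). With this representation define $h^{<n>}=\sum_{j=i}^{n}\binom{h(j)+j+1}{j}$; also $0^{<n>}=0$. -}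

module Defs where

open import Data.Nat using (ℕ; zero; suc; _+_; _∸_; _≤?_)
open import Data.Nat.Combinatorics using (_C_)
open import Relation.Nullary using (yes; no)

findK : ℕ → ℕ → ℕ → ℕ
findK n h zero = n
findK n h (suc m) with ((n + suc m) C n) ≤? h
... | yes _ = n + suc m
... | no  _ = findK n h m

-- The n-th binomial (Macaulay) representation h = Σ_{j=i}^{n} C(h(j)+j, j)
-- with h(n) ≥ … ≥ h(i) ≥ 0 is computed greedily: k_n = h(n)+n is the
-- largest k with C(k,n) ≤ h, and the remainder h - C(k_n,n) is represented
-- in degree n-1 (stopping when it is 0).  Then
-- h^{<n>} = Σ_{j=i}^{n} C(h(j)+j+1, j), and 0^{<n>} = 0.
upper : ℕ → ℕ → ℕ
upper zero h = 0
upper (suc n) zero = 0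
upper (suc n) (suc h) =
  let k = findK (suc n) (suc h) (suc h)
      r = suc h ∸ (k C suc n)
  in (suc k C suc n) + upper n r

module Submission where

-- List the degree-α monomials in n + 1 variables in lexicographic order and record for each
-- one the number k of variables after its largest one. Summing C(k + t, t) over the first h
-- entries gives the t-fold iterate of h ↦ h^{<n>}; in particular h^{<n>} and (h^{<n>})^{<n>} are
-- prefix sums of this sequence for the weights k + 1 and C(k + 2, 2).
-- For every monotone weight, no window of the sequence is heavier than the initial window of
-- the same length, nor lighter than the final one. This follows by induction along the
-- splitting of the sequence for (n, α + 1) into those for (n, α) and (n − 1, α + 1). With
-- N = C(α + n, n) the length of the sequence and N + a = b + c, the windows [b, N) and [a, c)
-- have the same length, which gives the inequality. For the equality case, the weights
-- C(k + 2, 2) and (n + 2)(k + 1) − C(k + 2, 2) are both monotone for k ≤ n and add up to a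
-- multiple of k + 1, so equality for the weight k + 1 forces equality for both.

open import Defs
open import Data.Nat using (ℕ; _+_; _≤_; _<_)
open import Data.Nat.Combinatorics using (_C_)
open import Data.Product using (_×_)
open import Relation.Binary.PropositionalEquality using (_≡_)

open import Data.List using (List; []; _∷_; _++_; take; length; map)
open import Data.List.Properties using (length-++; length-take; take-all; map-++; ++-assoc; ++-identityʳ)
open import Data.List.Relation.Unary.All as All using (All; []; _∷_)
open import Data.List.Relation.Unary.All.Properties using (++⁺; take⁺)
open import Data.Nat using (zero; suc; _*_; _∸_; z≤n; s≤s; _≤?_; _≤′_; ≤′-refl; ≤′-step)
open import Data.Nat.Combinatorics using (nCn≡1) renaming (nCk+nC[k+1]≡[n+1]C[k+1] to pascal)
open import Data.Nat.ListAction using (sum)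
open import Data.Nat.ListAction.Properties using (sum-++)
open import Data.Nat.Properties
open import Algebra.Properties.CommutativeSemigroup +-commutativeSemigroup
  using (x∙yz≈y∙xz; x∙yz≈xz∙y; x∙yz≈yx∙z; xy∙z≈xz∙y; interchange)
open import Data.Nat.Tactic.RingSolver using (solve-∀)
open import Data.Product using (_,_; ∃-syntax; proj₁; proj₂)
open import Data.Sum using (inj₁; inj₂)
open import Relation.Binary.Definitions using (tri<; tri≈; tri>)
open import Relation.Binary.PropositionalEquality using (refl; sym; trans; cong; cong₂; subst; subst₂)
open import Relation.Nullary using (yes; no; contradiction)

open ≤-Reasoning

mono-≤-by-steps : (f : ℕ → ℕ) → (∀ m → f m ≤ f (suc m)) → ∀ {m n} → m ≤ n → f m ≤ f n
mono-≤-by-steps f step {m} m≤n = go (≤⇒≤′ m≤n)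
  where
  go : ∀ {n} → m ≤′ n → f m ≤ f n
  go ≤′-refl        = ≤-refl
  go (≤′-step m≤′n) = ≤-trans (go m≤′n) (step _)

C-monoˡ-≤ : ∀ k {m n} → m ≤ n → m C k ≤ n C k
C-monoˡ-≤ k = mono-≤-by-steps (_C k) (step k)
  where
  step : ∀ k n → n C k ≤ suc n C k
  step zero    n = ≤-refl
  step (suc k) n = ≤-trans (m≤n+m (n C suc k) (n C k)) (≤-reflexive (pascal n k))

0<nCk : ∀ {n k} → k ≤ n → 0 < n C k
0<nCk {k = zero}          _         = s≤s z≤n
0<nCk {suc n} {suc k} (s≤s k≤n) =
  ≤-trans (0<nCk k≤n) (≤-trans (m≤m+n (n C k) (n C suc k)) (≤-reflexive (pascal n k)))

[1+n+1+j]C[1+n]≡[1+n+j]C[1+n]+[1+n+j]Cn : ∀ n j → (suc n + suc j) C suc n ≡ (suc n + j) C suc n + (suc n + j) C n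
[1+n+1+j]C[1+n]≡[1+n+j]C[1+n]+[1+n+j]Cn n j = begin-equality
  (suc n + suc j) C suc n                   ≡⟨ cong (_C suc n) (+-suc (suc n) j) ⟩
  suc (suc n + j) C suc n                   ≡⟨ pascal (suc n + j) n ⟨
  (suc n + j) C n + (suc n + j) C suc n     ≡⟨ +-comm ((suc n + j) C n) _ ⟩
  (suc n + j) C suc n + (suc n + j) C n     ∎

j<[1+n+j]C[1+n] : ∀ n j → j < (suc n + j) C suc n
j<[1+n+j]C[1+n] n zero    = ≤-reflexive (sym (trans (cong (_C suc n) (+-identityʳ (suc n))) (nCn≡1 (suc n))))
j<[1+n+j]C[1+n] n (suc j) = begin-strict
  suc j                                   <⟨ +-monoʳ-< 1 (j<[1+n+j]C[1+n] n j) ⟩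
  1 + (suc n + j) C suc n                 ≤⟨ +-monoˡ-≤ _ (0<nCk (≤-trans (n≤1+n n) (m≤m+n (suc n) j))) ⟩
  (suc n + j) C n + (suc n + j) C suc n   ≡⟨ +-comm _ ((suc n + j) C suc n) ⟩
  (suc n + j) C suc n + (suc n + j) C n   ≡⟨ [1+n+1+j]C[1+n]≡[1+n+j]C[1+n]+[1+n+j]Cn n j ⟨
  (suc n + suc j) C suc n                 ∎

-- j is the leading coefficient h(suc n) of the (suc n)-th binomial representation of h.
LeadingIndex : ℕ → ℕ → ℕ → Set
LeadingIndex n j h = (suc n + j) C suc n ≤ h × h < (suc n + suc j) C suc n

leadingIndex-unique : ∀ {n h j j′} → LeadingIndex n j h → LeadingIndex n j′ h → j ≡ j′
leadingIndex-unique {n} {h} {j} {j′} (lo , hi) (lo′ , hi′) with <-cmp j j′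
... | tri≈ _ j≡j′ _ = j≡j′
... | tri< j<j′ _ _ = contradiction (≤-trans (C-monoˡ-≤ (suc n) (+-monoʳ-≤ (suc n) j<j′)) lo′) (<⇒≱ hi)
... | tri> _ _ j′<j = contradiction (≤-trans (C-monoˡ-≤ (suc n) (+-monoʳ-≤ (suc n) j′<j)) lo) (<⇒≱ hi′)

leadingIndex⇒residual< : ∀ n j {r} → LeadingIndex n j ((suc n + j) C suc n + r) → r < (suc n + j) C n
leadingIndex⇒residual< n j (_ , hi) =
  +-cancelˡ-< ((suc n + j) C suc n) _ _ (≤-trans hi (≤-reflexive ([1+n+1+j]C[1+n]≡[1+n+j]C[1+n]+[1+n+j]Cn n j)))

residual<⇒leadingIndex : ∀ n j {r} → r < (suc n + j) C n → LeadingIndex n j ((suc n + j) C suc n + r)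
residual<⇒leadingIndex n j {r} r<C =
  m≤m+n _ r , ≤-trans (+-monoʳ-< ((suc n + j) C suc n) r<C) (≤-reflexive (sym ([1+n+1+j]C[1+n]≡[1+n+j]C[1+n]+[1+n+j]Cn n j)))

findK-leadingIndex : ∀ n h m → 1 ≤ h → h < (suc n + suc m) C suc n →
                     ∃[ j ] findK (suc n) h m ≡ suc n + j × LeadingIndex n j h
findK-leadingIndex n h zero 1≤h h<C =
  0 , sym (+-identityʳ (suc n)) , ≤-trans (≤-reflexive C≡1) 1≤h , h<C
  where
  C≡1 : (suc n + 0) C suc n ≡ 1
  C≡1 = trans (cong (_C suc n) (+-identityʳ (suc n))) (nCn≡1 (suc n))
findK-leadingIndex n h (suc m) 1≤h h<C with (suc n + suc m) C suc n ≤? h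
... | yes C≤h = suc m , refl , C≤h , h<C
... | no  C≰h = findK-leadingIndex n h m 1≤h (≰⇒> C≰h)

findK-upper : ∀ n h → ∃[ j ] findK (suc n) (suc h) (suc h) ≡ suc n + j × LeadingIndex n j (suc h)
findK-upper n h = findK-leadingIndex n (suc h) (suc h) (s≤s z≤n)
  (<-trans (n<1+n (suc h)) (j<[1+n+j]C[1+n] n (suc (suc h))))

data BinomialView (n : ℕ) : ℕ → Set where
  zero : BinomialView n 0
  lead : ∀ j {r} → r < (suc n + j) C n → BinomialView n ((suc n + j) C suc n + r)

binomialView : ∀ n x → BinomialView n x
binomialView n zero    = zero
binomialView n (suc h) with findK-upper n h
... | j , _ , lo , hi = subst (BinomialView n) (m+[n∸m]≡n lo)
                          (lead j (leadingIndex⇒residual< n j (subst (LeadingIndex n j) (sym (m+[n∸m]≡n lo)) (lo , hi))))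

upper-lead : ∀ n j {r} → r < (suc n + j) C n →
             upper (suc n) ((suc n + j) C suc n + r) ≡ suc (suc n + j) C suc n + upper n r
upper-lead n j {r} r<C = go _ refl
  where
  c = (suc n + j) C suc n
  go : ∀ h → h ≡ c + r → upper (suc n) h ≡ suc (suc n + j) C suc n + upper n r
  go zero    0≡ = contradiction 0≡ (<⇒≢ (≤-trans (0<nCk (m≤m+n (suc n) j)) (m≤m+n c r)))
  go (suc h) eq with findK-upper n h
  ... | j′ , findK≡ , li with leadingIndex-unique {n} {suc h} {j′} {j} li (subst (LeadingIndex n j) (sym eq) (residual<⇒leadingIndex n j r<C))
  ...   | refl rewrite findK≡ =
    cong (λ s → suc (suc n + j) C suc n + upper n s) (trans (cong (_∸ c) eq) (m+n∸m≡n c r))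

take-++ˡ : ∀ {A : Set} (xs ys : List A) {k} → k ≤ length xs → take k (xs ++ ys) ≡ take k xs
take-++ˡ xs       ys {zero}  _           = refl
take-++ˡ (x ∷ xs) ys {suc k} (s≤s k≤len) = cong (x ∷_) (take-++ˡ xs ys k≤len)

take-++ʳ : ∀ {A : Set} (xs ys : List A) k → take (length xs + k) (xs ++ ys) ≡ xs ++ take k ys
take-++ʳ []       ys k = refl
take-++ʳ (x ∷ xs) ys k = cong (x ∷_) (take-++ʳ xs ys k)

prefixSum : (ℕ → ℕ) → List ℕ → ℕ → ℕ
prefixSum w s x = sum (map w (take x s))

prefixSum-++ˡ : ∀ w X Y {x} → x ≤ length X → prefixSum w (X ++ Y) x ≡ prefixSum w X x
prefixSum-++ˡ w X Y x≤ = cong (λ s → sum (map w s)) (take-++ˡ X Y x≤)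

prefixSum-length : ∀ w X → prefixSum w X (length X) ≡ sum (map w X)
prefixSum-length w X = cong (λ s → sum (map w s)) (take-all (length X) X ≤-refl)

prefixSum-++ʳ : ∀ w X Y y → prefixSum w (X ++ Y) (length X + y) ≡ prefixSum w X (length X) + prefixSum w Y y
prefixSum-++ʳ w X Y y = begin-equality
  sum (map w (take (length X + y) (X ++ Y)))      ≡⟨ cong (λ s → sum (map w s)) (take-++ʳ X Y y) ⟩
  sum (map w (X ++ take y Y))                     ≡⟨ cong sum (map-++ w X (take y Y)) ⟩
  sum (map w X ++ map w (take y Y))               ≡⟨ sum-++ (map w X) _ ⟩
  sum (map w X) + prefixSum w Y y                 ≡⟨ cong (_+ prefixSum w Y y) (prefixSum-length w X) ⟨
  prefixSum w X (length X) + prefixSum w Y y      ∎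

prefixSum<sum : ∀ w → (∀ m → 0 < w m) → ∀ s {x} → x < length s → prefixSum w s x < sum (map w s)
prefixSum<sum w w>0 (y ∷ s) {zero}  _         = ≤-trans (w>0 y) (m≤m+n (w y) _)
prefixSum<sum w w>0 (y ∷ s) {suc x} (s≤s x<n) = +-monoʳ-< (w y) (prefixSum<sum w w>0 s x<n)

-- For a prefix-sum function p, p v + p u′ ≤ p v′ + p u compares the window sums
-- p v ∸ p u ≤ p v′ ∸ p u′ of two windows of equal length, with the subtractions moved across.
Subadditive : (ℕ → ℕ) → ℕ → Set
Subadditive p L = ∀ a d → a + d ≤ L → p (a + d) ≤ p a + p d

FinalWindowLightest : (ℕ → ℕ) → ℕ → Set
FinalWindowLightest p L = ∀ a b d → a + d ≤ L → b + d ≡ L → p L + p a ≤ p (a + d) + p b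

PrefixesDominate : (ℕ → ℕ) → ℕ → (ℕ → ℕ) → ℕ → Set
PrefixesDominate pX LX pY LY = ∀ e → e ≤ LX → e ≤ LY → pY e ≤ pX e

SuffixesDominate : (ℕ → ℕ) → ℕ → (ℕ → ℕ) → ℕ → Set
SuffixesDominate pX LX pY LY = ∀ e bX bY → bX + e ≡ LX → bY + e ≡ LY → pY LY + pX bX ≤ pX LX + pY bY

module Concatenation
  {LX LY : ℕ} {pX pY pZ : ℕ → ℕ}
  (glueˡ : ∀ x → x ≤ LX → pZ x ≡ pX x)
  (glueʳ : ∀ y → pZ (LX + y) ≡ pX LX + pY y)
  (pY0≡0 : pY 0 ≡ 0)
  where

  straddle : ∀ a e f → a + e ≡ LX → pZ (a + (e + f)) ≡ pX LX + pY f
  straddle a e f a+e≡LX = trans (cong pZ (trans (sym (+-assoc a e f)) (cong (_+ f) a+e≡LX))) (glueʳ f)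

  prefixesDominate-++ : ∀ {pW LW} → Subadditive pW LW →
                        PrefixesDominate pX LX pW LW → PrefixesDominate pY LY pW LW →
                        PrefixesDominate pZ (LX + LY) pW LW
  prefixesDominate-++ {pW} subW domX domY e e≤L e≤LW with ≤-total e LX
  ... | inj₁ e≤LX = ≤-trans (domX e e≤LX e≤LW) (≤-reflexive (sym (glueˡ e e≤LX)))
  ... | inj₂ LX≤e with m≤n⇒∃[o]m+o≡n LX≤e
  ...   | f , refl = begin
    pW (LX + f)     ≤⟨ subW LX f e≤LW ⟩
    pW LX + pW f    ≤⟨ +-mono-≤ (domX LX ≤-refl (m+n≤o⇒m≤o LX e≤LW))
                                (domY f (+-cancelˡ-≤ LX f LY e≤L) (m+n≤o⇒n≤o LX e≤LW)) ⟩
    pX LX + pY f    ≡⟨ glueʳ f ⟨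
    pZ (LX + f)     ∎

  suffixesDominate-++ : ∀ {pW LW} → FinalWindowLightest pW LW →
                        SuffixesDominate pW LW pX LX → SuffixesDominate pW LW pY LY →
                        SuffixesDominate pW LW pZ (LX + LY)
  suffixesDominate-++ {pW} {LW} finW domX domY e bW bZ bW+e≡LW bZ+e≡L with ≤-total LX bZ
  ... | inj₁ LX≤bZ with m≤n⇒∃[o]m+o≡n LX≤bZ
  ...   | bY , refl = begin
    pZ (LX + LY) + pW bW         ≡⟨ cong (_+ pW bW) (glueʳ LY) ⟩
    (pX LX + pY LY) + pW bW      ≡⟨ +-assoc (pX LX) (pY LY) (pW bW) ⟩
    pX LX + (pY LY + pW bW)      ≤⟨ +-monoʳ-≤ (pX LX) (domY e bW bY bW+e≡LW bY+e≡LY) ⟩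
    pX LX + (pW LW + pY bY)      ≡⟨ x∙yz≈y∙xz (pX LX) (pW LW) (pY bY) ⟩
    pW LW + (pX LX + pY bY)      ≡⟨ cong (pW LW +_) (glueʳ bY) ⟨
    pW LW + pZ (LX + bY)         ∎
    where
    bY+e≡LY = +-cancelˡ-≡ LX (bY + e) LY (trans (sym (+-assoc LX bY e)) bZ+e≡L)
  -- The final e-window of Z is the final f-window of X followed by all of Y. The first part is
  -- at most the final f-window of W, hence at most [bW, bW + f) by finW; the second is at most
  -- the final LY-window [bW + f, LW) of W.
  suffixesDominate-++ {pW} {LW} finW domX domY e bW bZ bW+e≡LW bZ+e≡L | inj₂ bZ≤LX with m≤n⇒∃[o]m+o≡n bZ≤LX
  ... | f , bZ+f≡LX with +-cancelˡ-≡ bZ e (f + LY) (trans bZ+e≡L (trans (cong (_+ LY) (sym bZ+f≡LX)) (+-assoc bZ f LY)))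
  ...   | refl = begin
    pZ (LX + LY) + pW bW          ≡⟨ cong (_+ pW bW) (glueʳ LY) ⟩
    (pX LX + pY LY) + pW bW       ≤⟨ +-cancelˡ-≤ s _ _ (begin
      s + ((pX LX + pY LY) + pW bW)                             ≡⟨ rearrange (pW c) (pW LW) (pW (bW + f)) (pX LX) (pY LY) (pW bW) ⟩
      ((pX LX + pW c) + (pW LW + pW bW)) + (pY LY + pW (bW + f)) ≤⟨ +-mono-≤ (+-mono-≤ i₁ i₂) i₃ ⟩
      ((pW LW + pX bZ) + (pW (bW + f) + pW c)) + pW LW          ≡⟨ rearrange′ (pW c) (pW LW) (pW (bW + f)) (pX bZ) ⟩
      s + (pW LW + pX bZ)                                       ∎) ⟩
    pW LW + pX bZ                 ≡⟨ cong (pW LW +_) (glueˡ bZ bZ≤LX) ⟨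
    pW LW + pZ bZ                 ∎
    where
    c = bW + LY
    s = pW c + pW LW + pW (bW + f)
    c+f≡LW : c + f ≡ LW
    c+f≡LW = trans (trans (+-assoc bW LY f) (cong (bW +_) (+-comm LY f))) bW+e≡LW
    bW+f+LY≡LW : bW + f + LY ≡ LW
    bW+f+LY≡LW = trans (+-assoc bW f LY) bW+e≡LW
    i₁ : pX LX + pW c ≤ pW LW + pX bZ
    i₁ = domX f c bZ c+f≡LW bZ+f≡LX
    i₂ : pW LW + pW bW ≤ pW (bW + f) + pW c
    i₂ = finW bW c f (m+n≤o⇒m≤o (bW + f) (≤-reflexive bW+f+LY≡LW)) c+f≡LW
    i₃ : pY LY + pW (bW + f) ≤ pW LW
    i₃ = subst (pY LY + pW (bW + f) ≤_) (trans (cong (pW LW +_) pY0≡0) (+-identityʳ (pW LW)))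
               (domY LY (bW + f) 0 bW+f+LY≡LW refl)
    rearrange : ∀ c L q x y b → (c + L + q) + ((x + y) + b) ≡ ((x + c) + (L + b)) + (y + q)
    rearrange = solve-∀
    rearrange′ : ∀ c L q z → ((L + z) + (q + c)) + L ≡ (c + L + q) + (L + z)
    rearrange′ = solve-∀

  module _
    (subX : Subadditive pX LX) (subY : Subadditive pY LY)
    (finX : FinalWindowLightest pX LX) (finY : FinalWindowLightest pY LY)
    (pre : PrefixesDominate pX LX pY LY) (suf : SuffixesDominate pX LX pY LY)
    where

    prefixY≤prefixZ : ∀ d → d ≤ LY → pY d ≤ pZ d
    prefixY≤prefixZ d d≤LY = prefixesDominate-++ subY pre (λ _ _ _ → ≤-refl) d (≤-trans d≤LY (m≤n+m LY LX)) d≤LY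

    subadditive-inX : ∀ a d → a + d ≤ LX → pZ (a + d) ≤ pZ a + pZ d
    subadditive-inX a d a+d≤LX = begin
      pZ (a + d)    ≡⟨ glueˡ (a + d) a+d≤LX ⟩
      pX (a + d)    ≤⟨ subX a d a+d≤LX ⟩
      pX a + pX d   ≡⟨ cong₂ _+_ (glueˡ a (m+n≤o⇒m≤o a a+d≤LX)) (glueˡ d (m+n≤o⇒n≤o a a+d≤LX)) ⟨
      pZ a + pZ d   ∎

    subadditive-inY : ∀ a d → a + d ≤ LY → pZ (LX + a + d) ≤ pZ (LX + a) + pZ d
    subadditive-inY a d a+d≤LY = begin
      pZ (LX + a + d)         ≡⟨ cong pZ (+-assoc LX a d) ⟩
      pZ (LX + (a + d))       ≡⟨ glueʳ (a + d) ⟩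
      pX LX + pY (a + d)      ≤⟨ +-monoʳ-≤ (pX LX) (subY a d a+d≤LY) ⟩
      pX LX + (pY a + pY d)   ≡⟨ +-assoc (pX LX) (pY a) (pY d) ⟨
      pX LX + pY a + pY d     ≤⟨ +-mono-≤ (≤-reflexive (sym (glueʳ a))) (prefixY≤prefixZ d (m+n≤o⇒n≤o a a+d≤LY)) ⟩
      pZ (LX + a) + pZ d      ∎

    subadditive-straddle : ∀ a e f → a + e ≡ LX → f ≤ LY → pZ (a + (e + f)) ≤ pZ a + pZ (e + f)
    subadditive-straddle a e f a+e≡LX f≤LY with ≤-total (e + f) LX
    ... | inj₁ e+f≤LX = begin
      pZ (a + (e + f))    ≡⟨ straddle a e f a+e≡LX ⟩
      pX LX + pY f        ≤⟨ +-monoʳ-≤ (pX LX) (pre f (m+n≤o⇒n≤o e e+f≤LX) f≤LY) ⟩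
      pX LX + pX f        ≤⟨ finX f a e (subst (_≤ LX) (+-comm e f) e+f≤LX) a+e≡LX ⟩
      pX (f + e) + pX a   ≡⟨ +-comm (pX (f + e)) (pX a) ⟩
      pX a + pX (f + e)   ≡⟨ cong₂ _+_ (glueˡ a a≤LX) (trans (glueˡ (e + f) e+f≤LX) (cong pX (+-comm e f))) ⟨
      pZ a + pZ (e + f)   ∎
      where
      a≤LX = m+n≤o⇒m≤o a (≤-reflexive a+e≡LX)
    ... | inj₂ LX≤e+f with m≤n⇒∃[o]m+o≡n LX≤e+f
    ...   | g , LX+g≡e+f = begin
      pZ (a + (e + f))          ≡⟨ straddle a e f a+e≡LX ⟩
      pX LX + pY f              ≡⟨ cong (λ x → pX LX + pY x) f≡a+g ⟩
      pX LX + pY (a + g)        ≤⟨ +-monoʳ-≤ (pX LX) (subY a g a+g≤LY) ⟩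
      pX LX + (pY a + pY g)     ≤⟨ +-monoʳ-≤ (pX LX) (+-monoˡ-≤ (pY g) (pre a a≤LX (m+n≤o⇒m≤o a a+g≤LY))) ⟩
      pX LX + (pX a + pY g)     ≡⟨ x∙yz≈y∙xz (pX LX) (pX a) (pY g) ⟩
      pX a + (pX LX + pY g)     ≡⟨ cong₂ _+_ (glueˡ a a≤LX) (trans (cong pZ (sym LX+g≡e+f)) (glueʳ g)) ⟨
      pZ a + pZ (e + f)         ∎
      where
      a≤LX = m+n≤o⇒m≤o a (≤-reflexive a+e≡LX)
      f≡a+g : f ≡ a + g
      f≡a+g = +-cancelˡ-≡ e f (a + g) (begin-equality
        e + f         ≡⟨ LX+g≡e+f ⟨
        LX + g        ≡⟨ cong (_+ g) a+e≡LX ⟨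
        a + e + g     ≡⟨ +-assoc a e g ⟩
        a + (e + g)   ≡⟨ x∙yz≈y∙xz a e g ⟩
        e + (a + g)   ∎)
      a+g≤LY = subst (_≤ LY) f≡a+g f≤LY

    subadditive : Subadditive pZ (LX + LY)
    subadditive a d a+d≤L with ≤-total (a + d) LX
    ... | inj₁ a+d≤LX = subadditive-inX a d a+d≤LX
    ... | inj₂ LX≤a+d with ≤-total LX a
    ...   | inj₁ LX≤a with m≤n⇒∃[o]m+o≡n LX≤a
    ...     | a′ , refl =
      subadditive-inY a′ d (+-cancelˡ-≤ LX _ _ (subst (_≤ LX + LY) (+-assoc LX a′ d) a+d≤L))
    subadditive a d a+d≤L | inj₂ LX≤a+d | inj₂ a≤LX with m≤n⇒∃[o]m+o≡n a≤LX
    ... | e , a+e≡LX with m≤n⇒∃[o]m+o≡n (+-cancelˡ-≤ a e d (subst (_≤ a + d) (sym a+e≡LX) LX≤a+d))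
    ...   | f , refl = subadditive-straddle a e f a+e≡LX
      (+-cancelˡ-≤ LX f LY (subst (_≤ LX + LY) (trans (sym (+-assoc a e f)) (cong (_+ f) a+e≡LX)) a+d≤L))

    final-inY-inY : ∀ a b d → a + d ≤ LY → b + d ≡ LY →
                    pZ (LX + LY) + pZ (LX + a) ≤ pZ (LX + a + d) + pZ (LX + b)
    final-inY-inY a b d a+d≤LY b+d≡LY = begin
      pZ (LX + LY) + pZ (LX + a)               ≡⟨ cong₂ _+_ (glueʳ LY) (glueʳ a) ⟩
      (pX LX + pY LY) + (pX LX + pY a)         ≡⟨ interchange (pX LX) (pY LY) (pX LX) (pY a) ⟩
      (pX LX + pX LX) + (pY LY + pY a)         ≤⟨ +-monoʳ-≤ (pX LX + pX LX) (finY a b d a+d≤LY b+d≡LY) ⟩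
      (pX LX + pX LX) + (pY (a + d) + pY b)    ≡⟨ interchange (pX LX) (pX LX) (pY (a + d)) (pY b) ⟩
      (pX LX + pY (a + d)) + (pX LX + pY b)    ≡⟨ cong₂ _+_ (trans (cong pZ (+-assoc LX a d)) (glueʳ (a + d))) (glueʳ b) ⟨
      pZ (LX + a + d) + pZ (LX + b)            ∎

    final-inY-inX : ∀ a b d → a + d ≤ LX → b + d ≡ LY → pZ (LX + LY) + pZ a ≤ pZ (a + d) + pZ (LX + b)
    final-inY-inX a b d a+d≤LX b+d≡LY with m≤n⇒∃[o]m+o≡n (m+n≤o⇒n≤o a a+d≤LX)
    ... | c , d+c≡LX = begin
      pZ (LX + LY) + pZ a                 ≡⟨ cong₂ _+_ (glueʳ LY) (glueˡ a (m+n≤o⇒m≤o a a+d≤LX)) ⟩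
      (pX LX + pY LY) + pX a              ≤⟨ +-cancelʳ-≤ (pX c) _ _ (begin
        (pX LX + pY LY) + pX a + pX c         ≡⟨ rearrange (pX LX) (pY LY) (pX a) (pX c) ⟩
        (pY LY + pX c) + (pX LX + pX a)       ≤⟨ +-mono-≤ (suf d c b c+d≡LX b+d≡LY) (finX a c d a+d≤LX c+d≡LX) ⟩
        (pX LX + pY b) + (pX (a + d) + pX c)  ≡⟨ rearrange′ (pX LX) (pY b) (pX (a + d)) (pX c) ⟩
        pX (a + d) + (pX LX + pY b) + pX c    ∎) ⟩
      pX (a + d) + (pX LX + pY b)         ≡⟨ cong₂ _+_ (glueˡ (a + d) a+d≤LX) (glueʳ b) ⟨
      pZ (a + d) + pZ (LX + b)            ∎
      where
      c+d≡LX = trans (+-comm c d) d+c≡LX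
      rearrange : ∀ x y z u → (x + y) + z + u ≡ (y + u) + (x + z)
      rearrange = solve-∀
      rearrange′ : ∀ x y z u → (x + y) + (z + u) ≡ z + (x + y) + u
      rearrange′ = solve-∀

    final-inY-straddle : ∀ a e f b → a + e ≡ LX → b + (e + f) ≡ LY →
                         pZ (LX + LY) + pZ a ≤ pZ (a + (e + f)) + pZ (LX + b)
    final-inY-straddle a e f b a+e≡LX b+e+f≡LY = begin
      pZ (LX + LY) + pZ a                 ≡⟨ cong₂ _+_ (glueʳ LY) (glueˡ a (m+n≤o⇒m≤o a (≤-reflexive a+e≡LX))) ⟩
      (pX LX + pY LY) + pX a              ≡⟨ +-assoc (pX LX) (pY LY) (pX a) ⟩
      pX LX + (pY LY + pX a)              ≤⟨ +-monoʳ-≤ (pX LX) (suf e a (b + f) a+e≡LX b+f+e≡LY) ⟩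
      pX LX + (pX LX + pY (b + f))        ≤⟨ +-monoʳ-≤ (pX LX) (+-monoʳ-≤ (pX LX) (subY b f b+f≤LY)) ⟩
      pX LX + (pX LX + (pY b + pY f))     ≡⟨ rearrange (pX LX) (pY b) (pY f) ⟩
      (pX LX + pY f) + (pX LX + pY b)     ≡⟨ cong₂ _+_ (straddle a e f a+e≡LX) (glueʳ b) ⟨
      pZ (a + (e + f)) + pZ (LX + b)      ∎
      where
      b+f+e≡LY : b + f + e ≡ LY
      b+f+e≡LY = trans (+-assoc b f e) (trans (cong (b +_) (+-comm f e)) b+e+f≡LY)
      b+f≤LY = m+n≤o⇒m≤o (b + f) (≤-reflexive b+f+e≡LY)
      rearrange : ∀ x y z → x + (x + (y + z)) ≡ (x + z) + (x + y)
      rearrange = solve-∀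

    -- The final window is the final h-window of X followed by all of Y. The first part is at most
    -- [a, a + h) by finX, the second at most the final LY-window of X by suf, hence at most
    -- [a + h, a + h + LY) by finX again.
    final-coversY-inX : ∀ a b h c → b + h ≡ LX → c + LY ≡ LX → a + (h + LY) ≤ LX →
                        pZ (LX + LY) + pZ a ≤ pZ (a + (h + LY)) + pZ b
    final-coversY-inX a b h c b+h≡LX c+LY≡LX a+h+LY≤LX = begin
      pZ (LX + LY) + pZ a                 ≡⟨ cong₂ _+_ (glueʳ LY) (glueˡ a (m+n≤o⇒m≤o a a+h+LY≤LX)) ⟩
      (pX LX + pY LY) + pX a              ≤⟨ +-cancelˡ-≤ s _ _ (begin
        s + ((pX LX + pY LY) + pX a)                                  ≡⟨ rearrange (pX LX) (pX (a + h)) (pX c) (pY LY) (pX a) ⟩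
        ((pX LX + pX a) + (pX LX + pX (a + h))) + (pY LY + pX c)      ≤⟨ +-mono-≤ (+-mono-≤ i₁ i₂) i₃ ⟩
        ((pX (a + h) + pX b) + (pX (a + h + LY) + pX c)) + pX LX      ≡⟨ rearrange′ (pX LX) (pX (a + h)) (pX c) (pX b) (pX (a + h + LY)) ⟩
        s + (pX (a + h + LY) + pX b)                                  ∎) ⟩
      pX (a + h + LY) + pX b              ≡⟨ cong₂ _+_ (trans (glueˡ _ a+h+LY≤LX) (cong pX (sym (+-assoc a h LY)))) (glueˡ b b≤LX) ⟨
      pZ (a + (h + LY)) + pZ b            ∎
      where
      s = pX LX + pX (a + h) + pX c
      b≤LX = m+n≤o⇒m≤o b (≤-reflexive b+h≡LX)
      a+h+LY≤LX′ = subst (_≤ LX) (sym (+-assoc a h LY)) a+h+LY≤LX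
      i₁ : pX LX + pX a ≤ pX (a + h) + pX b
      i₁ = finX a b h (m+n≤o⇒m≤o (a + h) a+h+LY≤LX′) b+h≡LX
      i₂ : pX LX + pX (a + h) ≤ pX (a + h + LY) + pX c
      i₂ = finX (a + h) c LY a+h+LY≤LX′ c+LY≡LX
      i₃ : pY LY + pX c ≤ pX LX
      i₃ = subst (pY LY + pX c ≤_) (trans (cong (pX LX +_) pY0≡0) (+-identityʳ (pX LX))) (suf LY c 0 c+LY≡LX refl)
      rearrange : ∀ L m x y z → (L + m + x) + ((L + y) + z) ≡ ((L + z) + (L + m)) + (y + x)
      rearrange = solve-∀
      rearrange′ : ∀ L m x b q → ((m + b) + (q + x)) + L ≡ (L + m + x) + (q + b)
      rearrange′ = solve-∀

    final-coversY-straddle : ∀ a c h g → a + c + h ≡ LX → LX + g ≡ a + (h + LY) →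
                             pZ (LX + LY) + pZ a ≤ pZ (a + (h + LY)) + pZ (a + c)
    final-coversY-straddle a c h g a+c+h≡LX LX+g≡a+h+LY = begin
      pZ (LX + LY) + pZ a                 ≡⟨ cong₂ _+_ (glueʳ LY) (glueˡ a (≤-trans (m≤m+n a c) a+c≤LX)) ⟩
      (pX LX + pY LY) + pX a              ≤⟨ +-cancelˡ-≤ (pX (a + h)) _ _ (begin
        pX (a + h) + ((pX LX + pY LY) + pX a)    ≡⟨ rearrange (pX (a + h)) (pX LX) (pY LY) (pX a) ⟩
        (pY LY + pX (a + h)) + (pX LX + pX a)    ≤⟨ +-mono-≤ (suf c (a + h) g a+h+c≡LX g+c≡LY) (finX a (a + h) c a+c≤LX a+h+c≡LX) ⟩
        (pX LX + pY g) + (pX (a + c) + pX (a + h)) ≡⟨ +-assoc (pX LX + pY g) (pX (a + c)) (pX (a + h)) ⟨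
        (pX LX + pY g) + pX (a + c) + pX (a + h)   ≡⟨ +-comm _ (pX (a + h)) ⟩
        pX (a + h) + ((pX LX + pY g) + pX (a + c)) ∎) ⟩
      (pX LX + pY g) + pX (a + c)         ≡⟨ cong₂ _+_ (trans (cong pZ (sym LX+g≡a+h+LY)) (glueʳ g)) (glueˡ (a + c) a+c≤LX) ⟨
      pZ (a + (h + LY)) + pZ (a + c)      ∎
      where
      a+c≤LX = m+n≤o⇒m≤o (a + c) (≤-reflexive a+c+h≡LX)
      a+h+c≡LX : a + h + c ≡ LX
      a+h+c≡LX = trans (xy∙z≈xz∙y a h c) a+c+h≡LX
      g+c≡LY : g + c ≡ LY
      g+c≡LY = +-cancelˡ-≡ (a + h) (g + c) LY (begin-equality
        a + h + (g + c)   ≡⟨ x∙yz≈xz∙y (a + h) g c ⟩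
        a + h + c + g     ≡⟨ cong (_+ g) a+h+c≡LX ⟩
        LX + g            ≡⟨ LX+g≡a+h+LY ⟩
        a + (h + LY)      ≡⟨ +-assoc a h LY ⟨
        a + h + LY        ∎)
      rearrange : ∀ m L y z → m + ((L + y) + z) ≡ (y + m) + (L + z)
      rearrange = solve-∀

    final-inY : ∀ a b d → a + d ≤ LX + LY → b + d ≡ LY → pZ (LX + LY) + pZ a ≤ pZ (a + d) + pZ (LX + b)
    final-inY a b d a+d≤L b+d≡LY with ≤-total LX a
    ... | inj₁ LX≤a with m≤n⇒∃[o]m+o≡n LX≤a
    ...   | a′ , refl =
      final-inY-inY a′ b d (+-cancelˡ-≤ LX _ _ (subst (_≤ LX + LY) (+-assoc LX a′ d) a+d≤L)) b+d≡LY
    final-inY a b d a+d≤L b+d≡LY | inj₂ a≤LX with ≤-total (a + d) LX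
    ... | inj₁ a+d≤LX = final-inY-inX a b d a+d≤LX b+d≡LY
    ... | inj₂ LX≤a+d with m≤n⇒∃[o]m+o≡n a≤LX
    ...   | e , a+e≡LX with m≤n⇒∃[o]m+o≡n (+-cancelˡ-≤ a e d (subst (_≤ a + d) (sym a+e≡LX) LX≤a+d))
    ...     | f , refl = final-inY-straddle a e f b a+e≡LX b+d≡LY

    final-coversY : ∀ a b h → a + (h + LY) ≤ LX + LY → b + h ≡ LX →
                    pZ (LX + LY) + pZ a ≤ pZ (a + (h + LY)) + pZ b
    final-coversY a b h a+d≤L b+h≡LX with ≤-total (a + (h + LY)) LX
    ... | inj₁ a+d≤LX with m≤n⇒∃[o]m+o≡n (m+n≤o⇒n≤o (a + h) (subst (_≤ LX) (sym (+-assoc a h LY)) a+d≤LX))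
    ...   | c , LY+c≡LX = final-coversY-inX a b h c b+h≡LX (trans (+-comm c LY) LY+c≡LX) a+d≤LX
    final-coversY a b h a+d≤L b+h≡LX | inj₂ LX≤a+d
      with m≤n⇒∃[o]m+o≡n (+-cancelʳ-≤ (h + LY) a b
             (subst (a + (h + LY) ≤_) (trans (cong (_+ LY) (sym b+h≡LX)) (+-assoc b h LY)) a+d≤L))
    ... | c , refl with m≤n⇒∃[o]m+o≡n LX≤a+d
    ...   | g , LX+g≡a+d = final-coversY-straddle a c h g b+h≡LX LX+g≡a+d

    finalWindowLightest : FinalWindowLightest pZ (LX + LY)
    finalWindowLightest a b d a+d≤L b+d≡L with ≤-total LX b
    ... | inj₁ LX≤b with m≤n⇒∃[o]m+o≡n LX≤b
    ...   | b′ , refl = final-inY a b′ d a+d≤L (+-cancelˡ-≡ LX _ _ (trans (sym (+-assoc LX b′ d)) b+d≡L))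
    finalWindowLightest a b d a+d≤L b+d≡L | inj₂ b≤LX with m≤n⇒∃[o]m+o≡n b≤LX
    ... | h , b+h≡LX with +-cancelˡ-≡ b d (h + LY) (trans b+d≡L (trans (cong (_+ LY) (sym b+h≡LX)) (+-assoc b h LY)))
    ...   | refl = final-coversY a b h a+d≤L b+h≡LX

-- lexSeq n α lists the monomials of degree α in x₀, …, xₙ in lexicographic order, each recorded
-- as k = n − i where xᵢ is the largest variable dividing it (i = 0 for the monomial 1). Such a
-- monomial u has exactly k + 1 multiples u xⱼ with j ≥ i, and these partition the monomials of
-- degree α + 1.
lexSeq : ℕ → ℕ → List ℕ
lexSeq zero    α       = 0 ∷ []
lexSeq (suc n) zero    = suc n ∷ []
lexSeq (suc n) (suc α) = lexSeq (suc n) α ++ lexSeq n (suc α)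

lexSeq-head : ∀ n α → ∃[ xs ] lexSeq n α ≡ n ∷ xs
lexSeq-head zero    α       = [] , refl
lexSeq-head (suc n) zero    = [] , refl
lexSeq-head (suc n) (suc α) with lexSeq-head (suc n) α
... | xs , eq = xs ++ lexSeq n (suc α) , cong (_++ lexSeq n (suc α)) eq

lexSeq-extends : ∀ n {α β} → α ≤ β → ∃[ ys ] lexSeq n β ≡ lexSeq n α ++ ys
lexSeq-extends n {α} α≤β = go (≤⇒≤′ α≤β)
  where
  step : ∀ n β → ∃[ ys ] lexSeq n (suc β) ≡ lexSeq n β ++ ys
  step zero    β = [] , refl
  step (suc n) β = lexSeq n (suc β) , refl
  go : ∀ {β} → α ≤′ β → ∃[ ys ] lexSeq n β ≡ lexSeq n α ++ ys
  go ≤′-refl = [] , sym (++-identityʳ _)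
  go (≤′-step {β} α≤′β) with go α≤′β | step n β
  ... | ys , eq | zs , eq′ = ys ++ zs , trans eq′ (trans (cong (_++ zs) eq) (++-assoc _ ys zs))

take-lexSeq : ∀ n {α β} x → x ≤ length (lexSeq n α) → x ≤ length (lexSeq n β) →
              take x (lexSeq n α) ≡ take x (lexSeq n β)
take-lexSeq n {α} {β} x x≤α x≤β with ≤-total α β
... | inj₁ α≤β with lexSeq-extends n α≤β
...   | ys , eq = sym (trans (cong (take x) eq) (take-++ˡ (lexSeq n α) ys x≤α))
take-lexSeq n {α} {β} x x≤α x≤β | inj₂ β≤α with lexSeq-extends n β≤α
...   | ys , eq = trans (cong (take x) eq) (take-++ˡ (lexSeq n β) ys x≤β)

lexSeq-suffix : ∀ α {m n} → m ≤ n → ∃[ ps ] lexSeq n (suc α) ≡ ps ++ lexSeq m (suc α)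
lexSeq-suffix α {m} m≤n = go (≤⇒≤′ m≤n)
  where
  go : ∀ {n} → m ≤′ n → ∃[ ps ] lexSeq n (suc α) ≡ ps ++ lexSeq m (suc α)
  go ≤′-refl = [] , refl
  go (≤′-step {n} m≤′n) with go m≤′n
  ... | ps , eq = lexSeq (suc n) α ++ ps ,
                  trans (cong (lexSeq (suc n) α ++_) eq) (sym (++-assoc (lexSeq (suc n) α) ps _))

lexSeq-bounded : ∀ n α → All (_≤ n) (lexSeq n α)
lexSeq-bounded zero    α       = z≤n ∷ []
lexSeq-bounded (suc n) zero    = ≤-refl ∷ []
lexSeq-bounded (suc n) (suc α) =
  ++⁺ (lexSeq-bounded (suc n) α) (All.map (m≤n⇒m≤1+n) (lexSeq-bounded n (suc α)))

wt : ℕ → ℕ → ℕ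
wt t m = (t + m) C m

wt-mono : ∀ t {x y} → x ≤ y → wt t x ≤ wt t y
wt-mono t = mono-≤-by-steps (wt t) step
  where
  step : ∀ m → wt t m ≤ wt t (suc m)
  step m = begin
    (t + m) C m                         ≤⟨ m≤m+n ((t + m) C m) ((t + m) C suc m) ⟩
    (t + m) C m + (t + m) C suc m       ≡⟨ pascal (t + m) m ⟩
    suc (t + m) C suc m                 ≡⟨ cong (_C suc m) (+-suc t m) ⟨
    (t + suc m) C suc m                 ∎

0<wt : ∀ t m → 0 < wt t m
0<wt t m = 0<nCk (m≤n+m m t)

sum-wt₀ : ∀ s → sum (map (wt 0) s) ≡ length s
sum-wt₀ []      = refl
sum-wt₀ (x ∷ s) = cong₂ _+_ (nCn≡1 x) (sum-wt₀ s)

prefixSum-wt₀ : ∀ s {x} → x ≤ length s → prefixSum (wt 0) s x ≡ x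
prefixSum-wt₀ s {x} x≤L = trans (sum-wt₀ (take x s)) (trans (length-take x s) (m≤n⇒m⊓n≡m x≤L))

sum-wt-lexSeq : ∀ t n α → sum (map (wt t) (lexSeq n α)) ≡ (t + α + n) C n
sum-wt-lexSeq t zero    α       = refl
sum-wt-lexSeq t (suc n) zero    = trans (+-identityʳ _) (cong (λ z → (z + suc n) C suc n) (sym (+-identityʳ t)))
sum-wt-lexSeq t (suc n) (suc α) = begin-equality
  sum (map (wt t) (lexSeq (suc n) α ++ lexSeq n (suc α)))
    ≡⟨ cong sum (map-++ (wt t) (lexSeq (suc n) α) _) ⟩
  sum (map (wt t) (lexSeq (suc n) α) ++ map (wt t) (lexSeq n (suc α)))
    ≡⟨ sum-++ (map (wt t) (lexSeq (suc n) α)) _ ⟩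
  sum (map (wt t) (lexSeq (suc n) α)) + sum (map (wt t) (lexSeq n (suc α)))
    ≡⟨ cong₂ _+_ (sum-wt-lexSeq t (suc n) α) (sum-wt-lexSeq t n (suc α)) ⟩
  (t + α + suc n) C suc n + (t + suc α + n) C n
    ≡⟨ cong (λ z → (t + α + suc n) C suc n + z C n) (t+[1+α]+n≡t+α+[1+n] t α n) ⟩
  (t + α + suc n) C suc n + (t + α + suc n) C n
    ≡⟨ +-comm ((t + α + suc n) C suc n) _ ⟩
  (t + α + suc n) C n + (t + α + suc n) C suc n
    ≡⟨ pascal (t + α + suc n) n ⟩
  suc (t + α + suc n) C suc n
    ≡⟨ cong (_C suc n) (cong (_+ suc n) (+-suc t α)) ⟨
  (t + suc α + suc n) C suc n
    ∎
  where
  t+[1+α]+n≡t+α+[1+n] : ∀ t α n → t + suc α + n ≡ t + α + suc n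
  t+[1+α]+n≡t+α+[1+n] = solve-∀

length-lexSeq : ∀ n α → length (lexSeq n α) ≡ (α + n) C n
length-lexSeq n α = trans (sym (sum-wt₀ (lexSeq n α))) (sum-wt-lexSeq 0 n α)

module Weighted (w : ℕ → ℕ) where

  P : List ℕ → ℕ → ℕ
  P = prefixSum w

  ExtremalWindows : List ℕ → Set
  ExtremalWindows s = Subadditive (P s) (length s) × FinalWindowLightest (P s) (length s)

  DominatesPrefixes : List ℕ → List ℕ → Set
  DominatesPrefixes X Y = PrefixesDominate (P X) (length X) (P Y) (length Y)

  DominatesSuffixes : List ℕ → List ℕ → Set
  DominatesSuffixes X Y = SuffixesDominate (P X) (length X) (P Y) (length Y)

  module ++-Concatenation (X Y : List ℕ) = Concatenation {length X} {length Y} {P X} {P Y} {P (X ++ Y)}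
    (λ x → prefixSum-++ˡ w X Y) (prefixSum-++ʳ w X Y) refl

  ++-extremalWindows : ∀ X Y → ExtremalWindows X → ExtremalWindows Y →
                       DominatesPrefixes X Y → DominatesSuffixes X Y → ExtremalWindows (X ++ Y)
  ++-extremalWindows X Y (subX , finX) (subY , finY) pre suf =
    subst (Subadditive (P (X ++ Y))) (sym (length-++ X)) (C.subadditive subX subY finX finY pre suf) ,
    subst (FinalWindowLightest (P (X ++ Y))) (sym (length-++ X)) (C.finalWindowLightest subX subY finX finY pre suf)
    where module C = ++-Concatenation X Y

  ++-dominatesPrefixes : ∀ X Y W → Subadditive (P W) (length W) →
                         DominatesPrefixes X W → DominatesPrefixes Y W → DominatesPrefixes (X ++ Y) W
  ++-dominatesPrefixes X Y W subW domX domY e e≤XY =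
    C.prefixesDominate-++ subW domX domY e (≤-trans e≤XY (≤-reflexive (length-++ X)))
    where module C = ++-Concatenation X Y

  ++-dominatedSuffixes : ∀ W X Y → FinalWindowLightest (P W) (length W) →
                         DominatesSuffixes W X → DominatesSuffixes W Y → DominatesSuffixes W (X ++ Y)
  ++-dominatedSuffixes W X Y finW domX domY =
    subst (SuffixesDominate (P W) (length W) (P (X ++ Y))) (sym (length-++ X)) (C.suffixesDominate-++ finW domX domY)
    where module C = ++-Concatenation X Y

  dominatedSuffixes-++ : ∀ ps Y → DominatesSuffixes (ps ++ Y) Y
  dominatedSuffixes-++ ps Y e bX bY bX+e≡L bY+e≡LY with +-cancelʳ-≡ e bX (length ps + bY) (begin-equality
    bX + e                    ≡⟨ bX+e≡L ⟩
    length (ps ++ Y)          ≡⟨ length-++ ps ⟩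
    length ps + length Y      ≡⟨ cong (length ps +_) bY+e≡LY ⟨
    length ps + (bY + e)      ≡⟨ +-assoc (length ps) bY e ⟨
    length ps + bY + e        ∎)
  ... | refl = ≤-reflexive (begin-equality
    P Y (length Y) + P (ps ++ Y) (length ps + bY)            ≡⟨ cong (P Y (length Y) +_) (prefixSum-++ʳ w ps Y bY) ⟩
    P Y (length Y) + (P ps (length ps) + P Y bY)             ≡⟨ x∙yz≈yx∙z (P Y (length Y)) (P ps (length ps)) (P Y bY) ⟩
    (P ps (length ps) + P Y (length Y)) + P Y bY             ≡⟨ cong (_+ P Y bY) (prefixSum-++ʳ w ps Y (length Y)) ⟨
    P (ps ++ Y) (length ps + length Y) + P Y bY              ≡⟨ cong (λ L → P (ps ++ Y) L + P Y bY) (length-++ ps) ⟨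
    P (ps ++ Y) (length (ps ++ Y)) + P Y bY                  ∎)

  singleton-extremalWindows : ∀ x → ExtremalWindows (x ∷ [])
  singleton-extremalWindows x = sub , fin
    where
    p = P (x ∷ [])
    sub : Subadditive p 1
    sub zero          d             _               = ≤-refl
    sub (suc zero)    zero          _               = ≤-reflexive (sym (+-identityʳ (p 1)))
    sub (suc zero)    (suc d)       (s≤s ())
    sub (suc (suc a)) d             (s≤s ())
    fin : FinalWindowLightest p 1
    fin zero          zero          (suc zero) _    refl = ≤-refl
    fin (suc zero)    zero          (suc zero) (s≤s ()) refl
    fin (suc (suc a)) zero          (suc zero) (s≤s ()) refl
    fin a             (suc zero)    zero       _    refl =
      ≤-reflexive (trans (+-comm (p 1) (p a)) (cong (λ z → p z + p 1) (sym (+-identityʳ a))))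
    fin a             (suc (suc b)) zero       _    ()

  dominatesSuffixes-singleton : ∀ X x → (∀ b → suc b ≡ length X → P X b + w x ≤ P X (suc b)) →
                                DominatesSuffixes X (x ∷ [])
  dominatesSuffixes-singleton X x last≥ e bX zero bX+e≡L refl = begin
    (w x + 0) + P X bX       ≡⟨ cong (_+ P X bX) (+-identityʳ (w x)) ⟩
    w x + P X bX             ≡⟨ +-comm (w x) (P X bX) ⟩
    P X bX + w x             ≤⟨ last≥ bX 1+bX≡L ⟩
    P X (suc bX)             ≡⟨ cong (P X) 1+bX≡L ⟩
    P X (length X)           ≡⟨ +-identityʳ (P X (length X)) ⟨
    P X (length X) + 0       ∎
    where 1+bX≡L = trans (+-comm 1 bX) bX+e≡L
  dominatesSuffixes-singleton X x last≥ e bX (suc zero) bX+e≡L refl =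
    ≤-reflexive (trans (+-comm (P (x ∷ []) 1) (P X bX)) (cong (λ b → P X b + P (x ∷ []) 1) (trans (sym (+-identityʳ bX)) bX+e≡L)))
  dominatesSuffixes-singleton X x last≥ e bX (suc (suc bY)) bX+e≡L ()

  module _ (w-mono : ∀ {x y} → x ≤ y → w x ≤ w y) where

    prefixSum-step : ∀ s b → suc b ≤ length s → P s b + w 0 ≤ P s (suc b)
    prefixSum-step (x ∷ xs) zero    _         = ≤-trans (w-mono z≤n) (m≤m+n (w x) 0)
    prefixSum-step (x ∷ xs) (suc b) (s≤s b<n) = begin
      w x + P xs b + w 0     ≡⟨ +-assoc (w x) (P xs b) (w 0) ⟩
      w x + (P xs b + w 0)   ≤⟨ +-monoʳ-≤ (w x) (prefixSum-step xs b b<n) ⟩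
      w x + P xs (suc b)     ∎

    lexSeq-dominatesPrefixes : ∀ n β → Subadditive (P (lexSeq n β)) (length (lexSeq n β)) →
                               ∀ α → DominatesPrefixes (lexSeq (suc n) α) (lexSeq n β)
    lexSeq-dominatesPrefixes n β subW zero    zero          _        _ = z≤n
    lexSeq-dominatesPrefixes n β subW zero    (suc zero)    _        _ with lexSeq-head n β
    ... | xs , eq rewrite eq = +-monoˡ-≤ 0 (w-mono (n≤1+n n))
    lexSeq-dominatesPrefixes n β subW zero    (suc (suc e)) (s≤s ()) _
    lexSeq-dominatesPrefixes n β subW (suc α) =
      ++-dominatesPrefixes (lexSeq (suc n) α) (lexSeq n (suc α)) (lexSeq n β) subW
        (lexSeq-dominatesPrefixes n β subW α)
        (λ e e≤X e≤W → ≤-reflexive (cong (λ s → sum (map w s)) (take-lexSeq n e e≤W e≤X)))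

    lexSeq-sameDegree-dominatesSuffixes : ∀ α {m n} → m ≤ n → DominatesSuffixes (lexSeq (suc n) α) (lexSeq (suc m) α)
    lexSeq-sameDegree-dominatesSuffixes zero    {m} {n} m≤n = dominatesSuffixes-singleton (suc n ∷ []) (suc m) last≥
      where
      last≥ : ∀ b → suc b ≡ 1 → P (suc n ∷ []) b + w (suc m) ≤ P (suc n ∷ []) (suc b)
      last≥ zero refl = ≤-trans (w-mono (s≤s m≤n)) (m≤m+n (w (suc n)) 0)
    lexSeq-sameDegree-dominatesSuffixes (suc α) {m} m≤n with lexSeq-suffix α (s≤s m≤n)
    ... | ps , eq = subst (λ X → DominatesSuffixes X (lexSeq (suc m) (suc α))) (sym eq) (dominatedSuffixes-++ ps _)

    lexSeq-dominatesSuffixes : ∀ n α → FinalWindowLightest (P (lexSeq (suc n) α)) (length (lexSeq (suc n) α)) →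
                               ∀ m → m ≤ n → DominatesSuffixes (lexSeq (suc n) α) (lexSeq m (suc α))
    lexSeq-dominatesSuffixes n α finX zero    _    =
      dominatesSuffixes-singleton (lexSeq (suc n) α) 0 (λ b 1+b≡L → prefixSum-step (lexSeq (suc n) α) b (≤-reflexive 1+b≡L))
    lexSeq-dominatesSuffixes n α finX (suc m) m<n =
      ++-dominatedSuffixes (lexSeq (suc n) α) (lexSeq (suc m) α) (lexSeq m (suc α)) finX
        (lexSeq-sameDegree-dominatesSuffixes α (<⇒≤ m<n))
        (lexSeq-dominatesSuffixes n α finX m (<⇒≤ m<n))

    lexSeq-extremalWindows : ∀ n α → ExtremalWindows (lexSeq n α)
    lexSeq-extremalWindows zero    α       = singleton-extremalWindows 0
    lexSeq-extremalWindows (suc n) zero    = singleton-extremalWindows (suc n)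
    lexSeq-extremalWindows (suc n) (suc α) =
      ++-extremalWindows (lexSeq (suc n) α) (lexSeq n (suc α)) exX exY
        (lexSeq-dominatesPrefixes n (suc α) (proj₁ exY) α)
        (lexSeq-dominatesSuffixes n α (proj₂ exX) n ≤-refl)
      where
      exX = lexSeq-extremalWindows (suc n) α
      exY = lexSeq-extremalWindows n (suc α)

    lexSeq-exchange : ∀ n α {a b c} → (α + n) C n + a ≡ b + c → b < (α + n) C n → c < (α + n) C n →
                      P (lexSeq n α) ((α + n) C n) + P (lexSeq n α) a ≤ P (lexSeq n α) b + P (lexSeq n α) c
    lexSeq-exchange n α {a} {b} {c} N+a≡b+c b<N c<N with m≤n⇒∃[o]m+o≡n (<⇒≤ b<N)
    ... | d , b+d≡N = begin
      P s N + P s a         ≡⟨ cong (λ x → P s x + P s a) N≡L ⟩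
      P s L + P s a         ≤⟨ proj₂ (lexSeq-extremalWindows n α) a b d a+d≤L (trans b+d≡N N≡L) ⟩
      P s (a + d) + P s b   ≡⟨ cong (λ x → P s x + P s b) a+d≡c ⟩
      P s c + P s b         ≡⟨ +-comm (P s c) (P s b) ⟩
      P s b + P s c         ∎
      where
      s = lexSeq n α
      L = length s
      N = (α + n) C n
      N≡L : N ≡ L
      N≡L = sym (length-lexSeq n α)
      a+d≡c : a + d ≡ c
      a+d≡c = +-cancelˡ-≡ b (a + d) c (begin-equality
        b + (a + d)   ≡⟨ x∙yz≈y∙xz b a d ⟩
        a + (b + d)   ≡⟨ cong (a +_) b+d≡N ⟩
        a + N         ≡⟨ +-comm a N ⟩
        N + a         ≡⟨ N+a≡b+c ⟩
        b + c         ∎)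
      a+d≤L : a + d ≤ L
      a+d≤L = ≤-trans (≤-reflexive a+d≡c) (≤-trans (<⇒≤ c<N) (≤-reflexive N≡L))


prefixSum-lead : ∀ t n α j {r} → r < (suc n + j) C n → (suc n + j) C suc n + r ≤ length (lexSeq (suc n) α) →
                 prefixSum (wt t) (lexSeq (suc n) α) ((suc n + j) C suc n + r)
                   ≡ (t + j + suc n) C suc n + prefixSum (wt t) (lexSeq n (suc j)) r
prefixSum-lead t n α j {r} r<C x≤L = begin-equality
  prefixSum (wt t) (lexSeq (suc n) α) x                     ≡⟨ cong (λ s → sum (map (wt t) s)) (take-lexSeq (suc n) {α} x x≤L x≤L′) ⟩
  prefixSum (wt t) (X ++ Y) x                               ≡⟨ cong (λ k → prefixSum (wt t) (X ++ Y) (k + r)) C≡|X| ⟩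
  prefixSum (wt t) (X ++ Y) (length X + r)                  ≡⟨ prefixSum-++ʳ (wt t) X Y r ⟩
  prefixSum (wt t) X (length X) + prefixSum (wt t) Y r      ≡⟨ cong (_+ prefixSum (wt t) Y r) (prefixSum-length (wt t) X) ⟩
  sum (map (wt t) X) + prefixSum (wt t) Y r                 ≡⟨ cong (_+ prefixSum (wt t) Y r) (sum-wt-lexSeq t (suc n) j) ⟩
  (t + j + suc n) C suc n + prefixSum (wt t) Y r            ∎
  where
  X = lexSeq (suc n) j
  Y = lexSeq n (suc j)
  x = (suc n + j) C suc n + r
  C≡|X| : (suc n + j) C suc n ≡ length X
  C≡|X| = trans (cong (_C suc n) (+-comm (suc n) j)) (sym (length-lexSeq (suc n) j))
  x≤L′ : x ≤ length (X ++ Y)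
  x≤L′ = ≤-trans (<⇒≤ (proj₂ (residual<⇒leadingIndex n j r<C)))
                 (≤-reflexive (trans (cong (_C suc n) (+-comm (suc n) (suc j))) (sym (length-lexSeq (suc n) (suc j)))))

upper-prefixSum : ∀ t n α x → x ≤ length (lexSeq (suc n) α) →
                  upper (suc n) (prefixSum (wt t) (lexSeq (suc n) α) x) ≡ prefixSum (wt (suc t)) (lexSeq (suc n) α) x
upper-prefixSum-residual : ∀ t n j r → r < (suc n + j) C n →
                           upper n (prefixSum (wt t) (lexSeq n (suc j)) r) ≡ prefixSum (wt (suc t)) (lexSeq n (suc j)) r

upper-prefixSum t n α x x≤L with binomialView n x
... | zero = refl
... | lead j {r} r<C = begin-equality
  upper (suc n) (prefixSum (wt t) S x)                        ≡⟨ cong (upper (suc n)) (prefixSum-lead t n α j r<C x≤L) ⟩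
  upper (suc n) ((t + j + suc n) C suc n + ρ)                 ≡⟨ cong (λ k → upper (suc n) (k C suc n + ρ)) (+-comm (t + j) (suc n)) ⟩
  upper (suc n) ((suc n + (t + j)) C suc n + ρ)               ≡⟨ upper-lead n (t + j) ρ<C ⟩
  suc (suc n + (t + j)) C suc n + upper n ρ                   ≡⟨ cong₂ _+_ (cong (λ k → suc k C suc n) (+-comm (suc n) (t + j)))
                                                                            (upper-prefixSum-residual t n j r r<C) ⟩
  (suc t + j + suc n) C suc n + prefixSum (wt (suc t)) Y r    ≡⟨ prefixSum-lead (suc t) n α j r<C x≤L ⟨
  prefixSum (wt (suc t)) S x                                  ∎
  where
  S = lexSeq (suc n) α
  Y = lexSeq n (suc j)
  ρ = prefixSum (wt t) Y r
  ρ<C : ρ < (suc n + (t + j)) C n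
  ρ<C = begin-strict
    ρ                       <⟨ prefixSum<sum (wt t) (0<wt t) Y (≤-trans r<C (≤-reflexive |Y|≡)) ⟩
    sum (map (wt t) Y)      ≡⟨ sum-wt-lexSeq t n (suc j) ⟩
    (t + suc j + n) C n     ≡⟨ cong (_C n) (t+[1+j]+n≡1+n+[t+j] t j n) ⟩
    (suc n + (t + j)) C n   ∎
    where
    |Y|≡ = trans (cong (λ k → suc k C n) (+-comm n j)) (sym (length-lexSeq n (suc j)))
    t+[1+j]+n≡1+n+[t+j] : ∀ t j n → t + suc j + n ≡ suc n + (t + j)
    t+[1+j]+n≡1+n+[t+j] = solve-∀

upper-prefixSum-residual t zero    j zero    _        = refl
upper-prefixSum-residual t zero    j (suc r) (s≤s ())
upper-prefixSum-residual t (suc n) j r       r<C      = upper-prefixSum t n (suc j) r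
  (≤-trans (<⇒≤ r<C) (≤-reflexive (trans (cong (λ k → suc k C suc n) (+-comm (suc n) j)) (sym (length-lexSeq (suc n) (suc j))))))

upper-lexSeq : ∀ n α {x} → x ≤ (α + suc n) C suc n → upper (suc n) x ≡ prefixSum (wt 1) (lexSeq (suc n) α) x
upper-lexSeq n α {x} x≤N =
  trans (cong (upper (suc n)) (sym (prefixSum-wt₀ (lexSeq (suc n) α) x≤L))) (upper-prefixSum 0 n α x x≤L)
  where x≤L = ≤-trans x≤N (≤-reflexive (sym (length-lexSeq (suc n) α)))

upper²-lexSeq : ∀ n α {x} → x ≤ (α + suc n) C suc n →
                upper (suc n) (upper (suc n) x) ≡ prefixSum (wt 2) (lexSeq (suc n) α) x
upper²-lexSeq n α {x} x≤N = trans (cong (upper (suc n)) (upper-lexSeq n α x≤N))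
  (upper-prefixSum 1 n α x (≤-trans x≤N (≤-reflexive (sym (length-lexSeq (suc n) α)))))

-- For m ≤ n, wt-complement n m = (n + 2)(m + 1) − C(m + 2, 2) (wt-complement+wt₂); the truncated
-- subtraction keeps it monotone for larger m, where this closed form decreases.
wt-complement : ℕ → ℕ → ℕ
wt-complement n zero    = suc n
wt-complement n (suc m) = wt-complement n m + (n ∸ m)

wt-complement-mono : ∀ n {x y} → x ≤ y → wt-complement n x ≤ wt-complement n y
wt-complement-mono n = mono-≤-by-steps (wt-complement n) (λ m → m≤m+n (wt-complement n m) (n ∸ m))

wt₁≡suc : ∀ m → wt 1 m ≡ suc m
wt₁≡suc zero    = refl
wt₁≡suc (suc m) = trans (sym (pascal (suc m) m)) (trans (cong₂ _+_ (wt₁≡suc m) (nCn≡1 (suc m))) (+-comm (suc m) 1))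

wt₂-suc : ∀ m → wt 2 (suc m) ≡ wt 2 m + suc (suc m)
wt₂-suc m = trans (sym (pascal (suc (suc m)) m)) (cong (wt 2 m +_) (wt₁≡suc (suc m)))

wt-complement+wt₂ : ∀ {n m} → m ≤ n → wt-complement n m + wt 2 m ≡ (2 + n) * wt 1 m
wt-complement+wt₂ {n} {m} m≤n = trans (go m m≤n) (cong ((2 + n) *_) (sym (wt₁≡suc m)))
  where
  go : ∀ m → m ≤ n → wt-complement n m + wt 2 m ≡ (2 + n) * suc m
  go zero    _   = trans (+-comm (suc n) 1) (sym (*-identityʳ (2 + n)))
  go (suc m) m<n = begin-equality
    wt-complement n m + (n ∸ m) + wt 2 (suc m)                  ≡⟨ cong (wt-complement n m + (n ∸ m) +_) (wt₂-suc m) ⟩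
    wt-complement n m + (n ∸ m) + (wt 2 m + suc (suc m))        ≡⟨ regroup (wt-complement n m) (n ∸ m) (wt 2 m) m ⟩
    (wt-complement n m + wt 2 m) + ((n ∸ m) + m) + 2            ≡⟨ cong₂ (λ u v → u + v + 2) (go m (<⇒≤ m<n)) (m∸n+n≡m (<⇒≤ m<n)) ⟩
    (2 + n) * suc m + n + 2                                     ≡⟨ expand n m ⟩
    (2 + n) * suc (suc m)                                       ∎
    where
    regroup : ∀ v d w m → v + d + (w + suc (suc m)) ≡ (v + w) + (d + m) + 2
    regroup = solve-∀
    expand : ∀ n m → (2 + n) * suc m + n + 2 ≡ (2 + n) * suc (suc m)
    expand = solve-∀

prefixSum-linear : ∀ {f g h : ℕ → ℕ} {Q : ℕ → Set} k → (∀ {m} → Q m → f m + g m ≡ k * h m) →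
                   ∀ {s} → All Q s → ∀ x → prefixSum f s x + prefixSum g s x ≡ k * prefixSum h s x
prefixSum-linear {f} {g} {h} k pointwise {s} qs x = sum-linear (take⁺ x qs)
  where
  sum-linear : ∀ {s} → All _ s → sum (map f s) + sum (map g s) ≡ k * sum (map h s)
  sum-linear []                = sym (*-zeroʳ k)
  sum-linear {m ∷ s} (q ∷ qs) = begin-equality
    (f m + sum (map f s)) + (g m + sum (map g s))   ≡⟨ interchange (f m) (sum (map f s)) (g m) (sum (map g s)) ⟩
    (f m + g m) + (sum (map f s) + sum (map g s))   ≡⟨ cong₂ _+_ (pointwise q) (sum-linear qs) ⟩
    k * h m + k * sum (map h s)                     ≡⟨ *-distribˡ-+ k (h m) (sum (map h s)) ⟨
    k * (h m + sum (map h s))                       ∎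

exchange-equality : ∀ (f g h : ℕ → ℕ) k → (∀ x → f x + g x ≡ k * h x) → ∀ {x y u v} →
                    h x + h y ≡ h u + h v → f x + f y ≤ f u + f v → g x + g y ≤ g u + g v →
                    g x + g y ≡ g u + g v
exchange-equality f g h k linear {x} {y} {u} {v} h-eq f≤ g≤ =
  ≤-antisym g≤ (+-cancelˡ-≤ (f x + f y) _ _ (begin
    (f x + f y) + (g u + g v)   ≤⟨ +-monoˡ-≤ (g u + g v) f≤ ⟩
    (f u + f v) + (g u + g v)   ≡⟨ pair u v ⟩
    k * (h u + h v)             ≡⟨ cong (k *_) h-eq ⟨
    k * (h x + h y)             ≡⟨ pair x y ⟨
    (f x + f y) + (g x + g y)   ∎))
  where
  pair : ∀ a b → (f a + f b) + (g a + g b) ≡ k * (h a + h b)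
  pair a b = trans (interchange (f a) (f b) (g a) (g b))
                   (trans (cong₂ _+_ (linear a) (linear b)) (sym (*-distribˡ-+ k (h a) (h b))))

lemma1p6 : (n α a b c : ℕ) → 1 ≤ n → 1 ≤ α → 1 ≤ a → 1 ≤ b → 1 ≤ c →
    ((α + n) C n) + a ≡ b + c →
    a < (α + n) C n → b < (α + n) C n → c < (α + n) C n →
    (upper n ((α + n) C n) + upper n a ≤ upper n b + upper n c)
    × (upper n ((α + n) C n) + upper n a ≡ upper n b + upper n c →
       upper n (upper n ((α + n) C n)) + upper n (upper n a)
         ≡ upper n (upper n b) + upper n (upper n c))
lemma1p6 zero    _ _ _ _ () _ _ _ _ _ _ _ _
lemma1p6 (suc n) α a b c _ _ _ _ _ N+a≡b+c a<N b<N c<N =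
  subst₂ _≤_ (sym (onNa (upper-lexSeq n α))) (sym (onbc (upper-lexSeq n α))) (exchange (wt 1) (wt-mono 1)) ,
  λ eq → subst₂ _≡_ (sym (onNa (upper²-lexSeq n α))) (sym (onbc (upper²-lexSeq n α)))
    (exchange-equality (prefixSum (wt-complement (suc n)) s) (prefixSum (wt 2) s) (prefixSum (wt 1) s) (2 + suc n)
      (prefixSum-linear (2 + suc n) wt-complement+wt₂ (lexSeq-bounded (suc n) α)) {N} {a} {b} {c}
      (subst₂ _≡_ (onNa (upper-lexSeq n α)) (onbc (upper-lexSeq n α)) eq)
      (exchange (wt-complement (suc n)) (wt-complement-mono (suc n)))
      (exchange (wt 2) (wt-mono 2)))
  where
  s = lexSeq (suc n) α
  N = (α + suc n) C suc n
  exchange : ∀ w → (∀ {x y} → x ≤ y → w x ≤ w y) →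
             prefixSum w s N + prefixSum w s a ≤ prefixSum w s b + prefixSum w s c
  exchange w w-mono = Weighted.lexSeq-exchange w w-mono (suc n) α N+a≡b+c b<N c<N
  onNa : ∀ {F G : ℕ → ℕ} → (∀ {x} → x ≤ N → F x ≡ G x) → F N + F a ≡ G N + G a
  onNa F≡G = cong₂ _+_ (F≡G ≤-refl) (F≡G (<⇒≤ a<N))
  onbc : ∀ {F G : ℕ → ℕ} → (∀ {x} → x ≤ N → F x ≡ G x) → F b + F c ≡ G b + G c
  onbc F≡G = cong₂ _+_ (F≡G (<⇒≤ b<N)) (F≡G (<⇒≤ c<N))
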